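{- Let $\phi$ be a quantifier-free sentence of $\mathscr{L}_{\max}$. For any $f:\mathbb{N}\to\mathbb{N}$, $\mathscr{M}_f\models\phi$ if and only if there is some $k$ such that for every $g:\mathbb{N}\to\mathbb{N}$ extending $(f(0),\ldots,f(k))$, $\mathscr{M}_g\models\phi$, and checking $\mathscr{M}_g\models\phi$ by the inductive definition of the semantics never requires querying $g(i)$ for any $i>k$.
   Context: $\mathbb{N}^{<\mathbb{N}}$ denotes the set of finite sequences of naturals. The language $\mathscr{L}_{\max}$ consists of: equality, the propositional connectives and quantifiers of first-order logic; a constant symbol $\mathbf{n}$ (also written $\bar n$) for each $n\in\mathbb{N}$; an $n$-ary function symbol $\tilde w$ for each $w:\mathbb{N}^n\to\mathbb{N}$ ($n>0$); an $n$-ary predicate symbol $\tilde p$ for each $p\subseteq\mathbb{N}^n$ ($n>0$); an "$\mathbb{N}^{<\mathbb{N}}$-ary" function symbol $\tilde G$ for each $G:\mathbb{N}^{<\mathbb{N}}\to\mathbb{N}$; one unary function symbol $\mathbf{f}$; and a special symbol $\cdots_x$ for each variable $x$. Terms: variables; constants; $h(t_1,\ldots,t_n)$ for an $n$-ary or $\mathbb{N}^{<\mathbb{N}}$-ary function symbol $h$ and terms $t_i$; and, for an $\mathbb{N}^{<\mathbb{N}}$-ary $G$, terms $u,v$ and variable $x$, the term $G(u(\mathbf{0}),\cdots_x,u(v))$ with free variables $(FV(u)\setminus\{x\})\cup FV(v)$. Formulas are built as in first-order logic. For $f:\mathbb{N}\to\mathbb{N}$, $\mathscr{M}_f$ is the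 structure with universe $\mathbb{N}$ interpreting $\mathbf n$ as $n$, $\tilde w$ as $w$, $\tilde p$ as $p$, $\tilde G$ as $G$, and $\mathbf f$ as $f$. Under an assignment $s$, terms are evaluated by the usual recursion plus $G(u(\mathbf 0),\cdots_x,u(v))^s=G\big(u(x|\mathbf 0)^s,\ldots,u(x|\overline{v^s})^s\big)$, where $u(x|\bar i)$ is $u$ with $\bar i$ substituted for $x$; satisfaction is as usual. "Querying $g(i)$" during the evaluation in $\mathscr{M}_g$ means evaluating a subterm $\mathbf f(t)$ with $t$ evaluating to $i$, so that $g(i)$ is used. -}

module Defs where

open import Data.Nat using (ℕ; zero; suc; _≤_; _≟_)
open import Data.Fin using (Fin)
open import Data.Vec using (Vec; []; _∷_; lookup)
open import Data.List as List using (List; []; _∷_; upTo; length)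
open import Data.Product using (_×_; Σ; ∃-syntax)
open import Data.Sum using (_⊎_)
open import Data.Empty using (⊥)
open import Data.Unit using (⊤)
open import Relation.Nullary using (¬_; yes; no)
open import Relation.Binary.PropositionalEquality using (_≡_)

Var : Set
Var = ℕ

-- Terms of L_max.  Non-logical symbols are represented by their
-- intended interpretations (w : ℕ^n → ℕ with n > 0, p ⊆ ℕ^n with n > 0,
-- G : ℕ^{<ℕ} → ℕ); `F` is the distinguished unary symbol 𝐟.

data Term : Set where
  var   : Var → Term
  const : ℕ → Term
  fun   : (n : ℕ) → (Vec ℕ (suc n) → ℕ) → Vec Term (suc n) → Term
  gapp  : (List ℕ → ℕ) → List Term → Term
  -- G(u(𝟎), ⋯ₓ, u(v)) : gdots G u x v
  gdots : (List ℕ → ℕ) → Term → Var → Term → Term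
  F     : Term → Term

data Formula : Set₁ where
  _≐_   : Term → Term → Formula
  rel   : (n : ℕ) → (Vec ℕ (suc n) → Set) → Vec Term (suc n) → Formula
  ⊤f ⊥f : Formula
  ¬f_   : Formula → Formula
  _∧f_ _∨f_ _⇒f_ _⇔f_ : Formula → Formula → Formula
  ∀f ∃f : Var → Formula → Formula

mutual
  data FreeT (y : Var) : Term → Set where
    fv-var   : FreeT y (var y)
    fv-fun   : ∀ {n w ts} (j : Fin (suc n)) → FreeT y (lookup ts j) → FreeT y (fun n w ts)
    fv-gapp  : ∀ {G ts} → FreeL y ts → FreeT y (gapp G ts)
    fv-gdu   : ∀ {G u x v} → FreeT y u → ¬ (y ≡ x) → FreeT y (gdots G u x v)
    fv-gdv   : ∀ {G u x v} → FreeT y v → FreeT y (gdots G u x v)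
    fv-F     : ∀ {t} → FreeT y t → FreeT y (F t)

  data FreeL (y : Var) : List Term → Set where
    here  : ∀ {t ts} → FreeT y t → FreeL y (t ∷ ts)
    there : ∀ {t ts} → FreeL y ts → FreeL y (t ∷ ts)

data FreeF (y : Var) : Formula → Set₁ where
  fv-eqˡ : ∀ {t u} → FreeT y t → FreeF y (t ≐ u)
  fv-eqʳ : ∀ {t u} → FreeT y u → FreeF y (t ≐ u)
  fv-rel : ∀ {n p ts} (j : Fin (suc n)) → FreeT y (lookup ts j) → FreeF y (rel n p ts)
  fv-¬   : ∀ {φ} → FreeF y φ → FreeF y (¬f φ)
  fv-∧ˡ  : ∀ {φ ψ} → FreeF y φ → FreeF y (φ ∧f ψ)
  fv-∧ʳ  : ∀ {φ ψ} → FreeF y ψ → FreeF y (φ ∧f ψ)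
  fv-∨ˡ  : ∀ {φ ψ} → FreeF y φ → FreeF y (φ ∨f ψ)
  fv-∨ʳ  : ∀ {φ ψ} → FreeF y ψ → FreeF y (φ ∨f ψ)
  fv-⇒ˡ  : ∀ {φ ψ} → FreeF y φ → FreeF y (φ ⇒f ψ)
  fv-⇒ʳ  : ∀ {φ ψ} → FreeF y ψ → FreeF y (φ ⇒f ψ)
  fv-⇔ˡ  : ∀ {φ ψ} → FreeF y φ → FreeF y (φ ⇔f ψ)
  fv-⇔ʳ  : ∀ {φ ψ} → FreeF y ψ → FreeF y (φ ⇔f ψ)
  fv-∀   : ∀ {x φ} → FreeF y φ → ¬ (y ≡ x) → FreeF y (∀f x φ)
  fv-∃   : ∀ {x φ} → FreeF y φ → ¬ (y ≡ x) → FreeF y (∃f x φ)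

Sentence : Formula → Set₁
Sentence φ = ∀ y → ¬ FreeF y φ

QF : Formula → Set
QF (_ ≐ _)    = ⊤
QF (rel _ _ _) = ⊤
QF ⊤f         = ⊤
QF ⊥f         = ⊤
QF (¬f φ)     = QF φ
QF (φ ∧f ψ)   = QF φ × QF ψ
QF (φ ∨f ψ)   = QF φ × QF ψ
QF (φ ⇒f ψ)   = QF φ × QF ψ
QF (φ ⇔f ψ)   = QF φ × QF ψ
QF (∀f _ _)   = ⊥
QF (∃f _ _)   = ⊥

-- Semantics in 𝓜_f (universe ℕ, symbols interpreted as themselves,
-- 𝐟 interpreted as f).

Assignment : Set
Assignment = Var → ℕ

_[_↦_] : Assignment → Var → ℕ → Assignment
(s [ x ↦ i ]) y with y ≟ x
... | yes _ = i
... | no  _ = s y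

mutual
  eval : (ℕ → ℕ) → Assignment → Term → ℕ
  eval f s (var x)         = s x
  eval f s (const n)       = n
  eval f s (fun n w ts)    = w (evalV f s ts)
  eval f s (gapp G ts)     = G (evalL f s ts)
  eval f s (gdots G u x v) =
    G (List.map (λ i → eval f (s [ x ↦ i ]) u) (upTo (suc (eval f s v))))
  eval f s (F t)           = f (eval f s t)

  evalV : ∀ {n} → (ℕ → ℕ) → Assignment → Vec Term n → Vec ℕ n
  evalV f s []       = []
  evalV f s (t ∷ ts) = eval f s t ∷ evalV f s ts

  evalL : (ℕ → ℕ) → Assignment → List Term → List ℕ
  evalL f s []       = []
  evalL f s (t ∷ ts) = eval f s t ∷ evalL f s ts

Sat : (ℕ → ℕ) → Assignment → Formula → Set
Sat f s (t ≐ u)     = eval f s t ≡ eval f s u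
Sat f s (rel n p ts) = p (evalV f s ts)
Sat f s ⊤f          = ⊤
Sat f s ⊥f          = ⊥
Sat f s (¬f φ)      = ¬ Sat f s φ
Sat f s (φ ∧f ψ)    = Sat f s φ × Sat f s ψ
Sat f s (φ ∨f ψ)    = Sat f s φ ⊎ Sat f s ψ
Sat f s (φ ⇒f ψ)    = Sat f s φ → Sat f s ψ
Sat f s (φ ⇔f ψ)    = (Sat f s φ → Sat f s ψ) × (Sat f s ψ → Sat f s φ)
Sat f s (∀f x φ)    = ∀ i → Sat f (s [ x ↦ i ]) φ
Sat f s (∃f x φ)    = ∃[ i ] Sat f (s [ x ↦ i ]) φ

record Model : Set where
  constructor 𝓜
  field 𝐟 : ℕ → ℕ

-- 𝓜_f ⊨ φ for a sentence φ (the assignment is irrelevant; we use 0 everywhere)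
_⊨_ : Model → Formula → Set
𝓜 f ⊨ φ = Sat f (λ _ → 0) φ

-- Queries: `QueryT g s t i` means that evaluating t under s in 𝓜_g
-- (by the recursive definition of term evaluation) evaluates a subterm
-- 𝐟(t') with t' evaluating to i, i.e. uses g(i).

mutual
  data QueryT (g : ℕ → ℕ) : Assignment → Term → ℕ → Set where
    q-F      : ∀ {s t i} → eval g s t ≡ i → QueryT g s (F t) i
    q-F-in   : ∀ {s t i} → QueryT g s t i → QueryT g s (F t) i
    q-fun    : ∀ {s n w ts i} (j : Fin (suc n)) → QueryT g s (lookup ts j) i → QueryT g s (fun n w ts) i
    q-gapp   : ∀ {s G ts i} → QueryL g s ts i → QueryT g s (gapp G ts) i
    q-gdots-v : ∀ {s G u x v i} → QueryT g s v i → QueryT g s (gdots G u x v) i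
    q-gdots-u : ∀ {s G u x v i} (j : ℕ) → j ≤ eval g s v →
                QueryT g (s [ x ↦ j ]) u i → QueryT g s (gdots G u x v) i

  data QueryL (g : ℕ → ℕ) : Assignment → List Term → ℕ → Set where
    here  : ∀ {s t ts i} → QueryT g s t i → QueryL g s (t ∷ ts) i
    there : ∀ {s t ts i} → QueryL g s ts i → QueryL g s (t ∷ ts) i

-- Queries made while checking satisfaction of a quantifier-free formula
-- by the inductive definition: all atomic subformulas are checked.
data QueryF (g : ℕ → ℕ) (s : Assignment) (i : ℕ) : Formula → Set₁ where
  q-eqˡ : ∀ {t u} → QueryT g s t i → QueryF g s i (t ≐ u)
  q-eqʳ : ∀ {t u} → QueryT g s u i → QueryF g s i (t ≐ u)
  q-rel : ∀ {n p ts} (j : Fin (suc n)) → QueryT g s (lookup ts j) i → QueryF g s i (rel n p ts)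
  q-¬   : ∀ {φ} → QueryF g s i φ → QueryF g s i (¬f φ)
  q-∧ˡ  : ∀ {φ ψ} → QueryF g s i φ → QueryF g s i (φ ∧f ψ)
  q-∧ʳ  : ∀ {φ ψ} → QueryF g s i ψ → QueryF g s i (φ ∧f ψ)
  q-∨ˡ  : ∀ {φ ψ} → QueryF g s i φ → QueryF g s i (φ ∨f ψ)
  q-∨ʳ  : ∀ {φ ψ} → QueryF g s i ψ → QueryF g s i (φ ∨f ψ)
  q-⇒ˡ  : ∀ {φ ψ} → QueryF g s i φ → QueryF g s i (φ ⇒f ψ)
  q-⇒ʳ  : ∀ {φ ψ} → QueryF g s i ψ → QueryF g s i (φ ⇒f ψ)
  q-⇔ˡ  : ∀ {φ ψ} → QueryF g s i φ → QueryF g s i (φ ⇔f ψ)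
  q-⇔ʳ  : ∀ {φ ψ} → QueryF g s i ψ → QueryF g s i (φ ⇔f ψ)

Queries : (ℕ → ℕ) → Formula → ℕ → Set₁
Queries g φ i = QueryF g (λ _ → 0) i φ

Extends : (ℕ → ℕ) → (ℕ → ℕ) → ℕ → Set
Extends g f k = ∀ i → i ≤ k → g i ≡ f i

module Submission where

-- Evaluating a term in 𝓜_g is a well-founded computation that
-- consults the oracle g at finitely many places only.  We make this precise
-- by the notion of a *settled* quantity: a value depending on the oracle is
-- settled at f with modulus K when every g agreeing with f on 0, …, K gives
-- the same value as f and, while being computed, queries g nowhere above K.
--
-- By structural recursion every term, list or vector of
-- terms, and quantifier-free formula then has a modulus (`formulaModulus`).
-- Corollary 3 follows: if 𝓜_f ⊨ φ, the modulus of φ is the required k; the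
-- converse is the instance g = f.

open import Defs
open import Level using (Level; _⊔_)
open import Data.Nat using (ℕ; zero; suc; _≤_; _>_; z≤n)
  renaming (_⊔_ to _⊔ℕ_)
open import Data.Nat.Properties
  using (≤-refl; ≤-trans; ≤-pred; m≤m⊔n; m≤n⊔m; ≤⇒≯; m≤n⇒m<n∨m≡n)
import Data.Fin as Fin
open import Data.Vec using (Vec; []; _∷_; lookup)
open import Data.List as List using (List; []; _∷_; upTo)
open import Data.List.Properties using (map-cong-local)
open import Data.List.Relation.Unary.All.Properties using (applyUpTo⁺₁)
open import Data.Product using (_×_; ∃-syntax; _,_; proj₁; proj₂)
open import Data.Product.Function.NonDependent.Propositional using (_×-⇔_)
open import Data.Sum using (_⊎_; inj₁; inj₂; [_,_]′)
open import Data.Sum.Function.Propositional using (_⊎-⇔_)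
open import Function using (id)
open import Function.Bundles using (_⇔_; mk⇔; Equivalence)
open import Function.Construct.Identity using (⇔-id)
open import Function.Related.TypeIsomorphisms using (→-cong-⇔; ¬-cong-⇔)
open import Relation.Nullary using (¬_)
open import Relation.Binary.PropositionalEquality
  using (_≡_; refl; sym; trans; cong; cong₂; subst; module ≡-Reasoning)

private
  variable
    a b c r₁ r₂ r q₁ q₂ q : Level
    A₁ : Set a
    A₂ : Set b
    A : Set c
    f : ℕ → ℕ
    s : Assignment
    K K′ K₁ K₂ : ℕ

extends-weaken : ∀ {g} → K′ ≤ K → Extends g f K → Extends g f K′
extends-weaken K′≤K g≈f i i≤K′ = g≈f i (≤-trans i≤K′ K′≤K)

supUpTo : (ℕ → ℕ) → ℕ → ℕ
supUpTo b zero    = b 0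
supUpTo b (suc n) = supUpTo b n ⊔ℕ b (suc n)

≤-supUpTo : ∀ (b : ℕ → ℕ) {j n} → j ≤ n → b j ≤ supUpTo b n
≤-supUpTo b {n = zero} z≤n = ≤-refl
≤-supUpTo b {n = suc n} j≤1+n with m≤n⇒m<n∨m≡n j≤1+n
... | inj₁ j<1+n = ≤-trans (≤-supUpTo b (≤-pred j<1+n)) (m≤m⊔n _ _)
... | inj₂ refl  = m≤n⊔m (supUpTo b n) (b (suc n))

record Settled {A : Set a} (_≈_ : A → A → Set r) (value : (ℕ → ℕ) → A)
               (Query : (ℕ → ℕ) → ℕ → Set q) (f : ℕ → ℕ) (K : ℕ) : Set (r ⊔ q) where
  constructor settled
  field
    agrees  : ∀ g → Extends g f K → value g ≈ value f
    bounded : ∀ g → Extends g f K → ∀ i → Query g i → i ≤ K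
open Settled

TermSettled : (ℕ → ℕ) → Assignment → Term → ℕ → Set
TermSettled f s t = Settled _≡_ (λ g → eval g s t) (λ g → QueryT g s t) f

VecSettled : ∀ {n} → (ℕ → ℕ) → Assignment → Vec Term n → ℕ → Set
VecSettled f s ts =
  Settled _≡_ (λ g → evalV g s ts) (λ g i → ∃[ j ] QueryT g s (lookup ts j) i) f

ListSettled : (ℕ → ℕ) → Assignment → List Term → ℕ → Set
ListSettled f s ts = Settled _≡_ (λ g → evalL g s ts) (λ g → QueryL g s ts) f

FormulaSettled : (ℕ → ℕ) → Assignment → Formula → ℕ → Set₁
FormulaSettled f s φ = Settled _⇔_ (λ g → Sat g s φ) (λ g i → QueryF g s i φ) f

settled-weaken : ∀ {_≈_ : A → A → Set r} {value : (ℕ → ℕ) → A}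
  {Query : (ℕ → ℕ) → ℕ → Set q} →
  K ≤ K′ → Settled _≈_ value Query f K → Settled _≈_ value Query f K′
settled-weaken K≤K′ h = settled
  (λ g g≈f → agrees h g (extends-weaken K≤K′ g≈f))
  (λ g g≈f i qi → ≤-trans (bounded h g (extends-weaken K≤K′ g≈f) i qi) K≤K′)

settled-map : ∀ {_≈₁_ : A₁ → A₁ → Set r₁} {_≈_ : A → A → Set r}
  {value₁ : (ℕ → ℕ) → A₁} {value : (ℕ → ℕ) → A}
  {Query₁ : (ℕ → ℕ) → ℕ → Set q₁} {Query : (ℕ → ℕ) → ℕ → Set q} →
  (∀ {g} → value₁ g ≈₁ value₁ f → value g ≈ value f) →
  (∀ {g i} → Query g i → Query₁ g i) →
  Settled _≈₁_ value₁ Query₁ f K → Settled _≈_ value Query f K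
settled-map transfer restrict h = settled
  (λ g g≈f → transfer (agrees h g g≈f))
  (λ g g≈f i qi → bounded h g g≈f i (restrict qi))

settled-combine : ∀ {_≈₁_ : A₁ → A₁ → Set r₁} {_≈₂_ : A₂ → A₂ → Set r₂}
  {_≈_ : A → A → Set r}
  {value₁ : (ℕ → ℕ) → A₁} {value₂ : (ℕ → ℕ) → A₂} {value : (ℕ → ℕ) → A}
  {Query₁ : (ℕ → ℕ) → ℕ → Set q₁} {Query₂ : (ℕ → ℕ) → ℕ → Set q₂}
  {Query : (ℕ → ℕ) → ℕ → Set q} →
  (∀ {g} → value₁ g ≈₁ value₁ f → value₂ g ≈₂ value₂ f → value g ≈ value f) →
  (∀ {g i} → Query g i → Query₁ g i ⊎ Query₂ g i) →
  Settled _≈₁_ value₁ Query₁ f K₁ → Settled _≈₂_ value₂ Query₂ f K₂ →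
  Settled _≈_ value Query f (K₁ ⊔ℕ K₂)
settled-combine {K₁ = K₁} {K₂ = K₂} transfer split h₁ h₂
  with settled-weaken (m≤m⊔n K₁ K₂) h₁ | settled-weaken (m≤n⊔m K₁ K₂) h₂
... | settled agrees₁ bounded₁ | settled agrees₂ bounded₂ = settled
  (λ g g≈f → transfer (agrees₁ g g≈f) (agrees₂ g g≈f))
  (λ g g≈f i qi → [ bounded₁ g g≈f i , bounded₂ g g≈f i ]′ (split qi))

-- Applying 𝐟: if t is settled with modulus K, then 𝐟(t) is settled once the
-- modulus also covers the one new query, the value n of t.
F-settled : ∀ {t} → TermSettled f s t K → TermSettled f s (F t) (K ⊔ℕ eval f s t)
F-settled {f} {s} {K} {t} h = settled value-agrees queries-bounded
  where
    n : ℕ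
    n = eval f s t
    t-settled : TermSettled f s t (K ⊔ℕ n)
    t-settled = settled-weaken (m≤m⊔n K n) h

    value-agrees : ∀ g → Extends g f (K ⊔ℕ n) → g (eval g s t) ≡ f n
    value-agrees g g≈f = begin
      g (eval g s t)  ≡⟨ cong g (agrees t-settled g g≈f) ⟩
      g n             ≡⟨ g≈f n (m≤n⊔m K n) ⟩
      f n             ∎
      where open ≡-Reasoning

    queries-bounded : ∀ g → Extends g f (K ⊔ℕ n) → ∀ i → QueryT g s (F t) i → i ≤ K ⊔ℕ n
    queries-bounded g g≈f i (q-F tᵍ≡i) =
      subst (_≤ K ⊔ℕ n) (trans (sym (agrees t-settled g g≈f)) tᵍ≡i) (m≤n⊔m K n)
    queries-bounded g g≈f i (q-F-in q) = bounded t-settled g g≈f i q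

-- Bounded iteration G(u(𝟎), ⋯ₓ, u(v)): with a modulus Kv for v and moduli
-- Ku j for u at x = j, it suffices to cover Kv and Ku 0, …, Ku N, where N is
-- the value of v; agreement up to Kv forces g to produce the same N.
gdots-settled : ∀ {G u x v Kv} (Ku : ℕ → ℕ) →
  TermSettled f s v Kv → (∀ j → TermSettled f (s [ x ↦ j ]) u (Ku j)) →
  TermSettled f s (gdots G u x v) (Kv ⊔ℕ supUpTo Ku (eval f s v))
gdots-settled {f} {s} {G} {u} {x} {v} {Kv} Ku hv hu =
  settled (λ g g≈f → cong G (instances-agree g g≈f)) queries-bounded
  where
    N : ℕ
    N = eval f s v
    modulus : ℕ
    modulus = Kv ⊔ℕ supUpTo Ku N

    v-settled : TermSettled f s v modulus
    v-settled = settled-weaken (m≤m⊔n Kv _) hv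

    u-settled : ∀ {j} → j ≤ N → TermSettled f (s [ x ↦ j ]) u modulus
    u-settled {j} j≤N = settled-weaken (≤-trans (≤-supUpTo Ku j≤N) (m≤n⊔m Kv _)) (hu j)

    instance-at : (ℕ → ℕ) → ℕ → ℕ
    instance-at g j = eval g (s [ x ↦ j ]) u

    instances-agree : ∀ g → Extends g f modulus →
      List.map (instance-at g) (upTo (suc (eval g s v))) ≡
      List.map (instance-at f) (upTo (suc N))
    instances-agree g g≈f = begin
      List.map (instance-at g) (upTo (suc (eval g s v)))
        ≡⟨ cong (λ m → List.map (instance-at g) (upTo (suc m))) (agrees v-settled g g≈f) ⟩
      List.map (instance-at g) (upTo (suc N))
        ≡⟨ map-cong-local (applyUpTo⁺₁ id (suc N)
             (λ j<1+N → agrees (u-settled (≤-pred j<1+N)) g g≈f)) ⟩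
      List.map (instance-at f) (upTo (suc N))  ∎
      where open ≡-Reasoning

    queries-bounded : ∀ g → Extends g f modulus → ∀ i → QueryT g s (gdots G u x v) i → i ≤ modulus
    queries-bounded g g≈f i (q-gdots-v q) = bounded v-settled g g≈f i q
    queries-bounded g g≈f i (q-gdots-u j j≤vᵍ q) =
      bounded (u-settled (subst (j ≤_) (agrees v-settled g g≈f) j≤vᵍ)) g g≈f i q

mutual
  termModulus : ∀ f s t → ∃[ K ] TermSettled f s t K
  termModulus f s (var x)      = 0 , settled (λ _ _ → refl) (λ _ _ _ ())
  termModulus f s (const n)    = 0 , settled (λ _ _ → refl) (λ _ _ _ ())
  termModulus f s (fun n w ts) with vecModulus f s ts
  ... | K , h = K , settled-map (cong w) (λ { (q-fun j q) → j , q }) h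
  termModulus f s (gapp G ts)  with listModulus f s ts
  ... | K , h = K , settled-map (cong G) (λ { (q-gapp q) → q }) h
  termModulus f s (F t)        with termModulus f s t
  ... | K , h = K ⊔ℕ eval f s t , F-settled h
  termModulus f s (gdots G u x v) with termModulus f s v
  ... | Kv , hv = Kv ⊔ℕ supUpTo Ku (eval f s v) , gdots-settled Ku hv hu
    where
      Ku : ℕ → ℕ
      Ku j = proj₁ (termModulus f (s [ x ↦ j ]) u)
      hu : ∀ j → TermSettled f (s [ x ↦ j ]) u (Ku j)
      hu j = proj₂ (termModulus f (s [ x ↦ j ]) u)

  vecModulus : ∀ {n} f s (ts : Vec Term n) → ∃[ K ] VecSettled f s ts K
  vecModulus f s []       = 0 , settled (λ _ _ → refl) (λ { _ _ _ (() , _) })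
  vecModulus f s (t ∷ ts) with termModulus f s t | vecModulus f s ts
  ... | K₁ , h₁ | K₂ , h₂ = K₁ ⊔ℕ K₂ , settled-combine (cong₂ _∷_) split h₁ h₂
    where
      split : ∀ {g i} → ∃[ j ] QueryT g s (lookup (t ∷ ts) j) i →
              QueryT g s t i ⊎ ∃[ j ] QueryT g s (lookup ts j) i
      split (Fin.zero  , q) = inj₁ q
      split (Fin.suc j , q) = inj₂ (j , q)

  listModulus : ∀ f s (ts : List Term) → ∃[ K ] ListSettled f s ts K
  listModulus f s []       = 0 , settled (λ _ _ → refl) (λ _ _ _ ())
  listModulus f s (t ∷ ts) with termModulus f s t | listModulus f s ts
  ... | K₁ , h₁ | K₂ , h₂ =
    K₁ ⊔ℕ K₂ , settled-combine (cong₂ _∷_) (λ { (here q) → inj₁ q ; (there q) → inj₂ q }) h₁ h₂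

formulaModulus : ∀ f s φ → QF φ → ∃[ K ] FormulaSettled f s φ K
formulaModulus f s (t ≐ u) _ with termModulus f s t | termModulus f s u
... | K₁ , h₁ | K₂ , h₂ = K₁ ⊔ℕ K₂ , settled-combine
  (λ tᵍ≡tᶠ uᵍ≡uᶠ → mk⇔ (λ tᵍ≡uᵍ → trans (sym tᵍ≡tᶠ) (trans tᵍ≡uᵍ uᵍ≡uᶠ))
                        (λ tᶠ≡uᶠ → trans tᵍ≡tᶠ (trans tᶠ≡uᶠ (sym uᵍ≡uᶠ))))
  (λ { (q-eqˡ q) → inj₁ q ; (q-eqʳ q) → inj₂ q }) h₁ h₂
formulaModulus f s (rel n p ts) _ with vecModulus f s ts
... | K , h = K , settled-map
  (λ tsᵍ≡tsᶠ → mk⇔ (subst p tsᵍ≡tsᶠ) (subst p (sym tsᵍ≡tsᶠ)))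
  (λ { (q-rel j q) → j , q }) h
formulaModulus f s ⊤f _ = 0 , settled (λ _ _ → ⇔-id _) (λ _ _ _ ())
formulaModulus f s ⊥f _ = 0 , settled (λ _ _ → ⇔-id _) (λ _ _ _ ())
formulaModulus f s (¬f φ) qf with formulaModulus f s φ qf
... | K , h = K , settled-map ¬-cong-⇔ (λ { (q-¬ q) → q }) h
formulaModulus f s (φ ∧f ψ) (qf₁ , qf₂)
  with formulaModulus f s φ qf₁ | formulaModulus f s ψ qf₂
... | K₁ , h₁ | K₂ , h₂ = K₁ ⊔ℕ K₂ , settled-combine _×-⇔_
  (λ { (q-∧ˡ q) → inj₁ q ; (q-∧ʳ q) → inj₂ q }) h₁ h₂
formulaModulus f s (φ ∨f ψ) (qf₁ , qf₂)
  with formulaModulus f s φ qf₁ | formulaModulus f s ψ qf₂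
... | K₁ , h₁ | K₂ , h₂ = K₁ ⊔ℕ K₂ , settled-combine _⊎-⇔_
  (λ { (q-∨ˡ q) → inj₁ q ; (q-∨ʳ q) → inj₂ q }) h₁ h₂
formulaModulus f s (φ ⇒f ψ) (qf₁ , qf₂)
  with formulaModulus f s φ qf₁ | formulaModulus f s ψ qf₂
... | K₁ , h₁ | K₂ , h₂ = K₁ ⊔ℕ K₂ , settled-combine →-cong-⇔
  (λ { (q-⇒ˡ q) → inj₁ q ; (q-⇒ʳ q) → inj₂ q }) h₁ h₂
formulaModulus f s (φ ⇔f ψ) (qf₁ , qf₂)
  with formulaModulus f s φ qf₁ | formulaModulus f s ψ qf₂
... | K₁ , h₁ | K₂ , h₂ = K₁ ⊔ℕ K₂ , settled-combine
  (λ φ⇔ ψ⇔ → →-cong-⇔ φ⇔ ψ⇔ ×-⇔ →-cong-⇔ ψ⇔ φ⇔)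
  (λ { (q-⇔ˡ q) → inj₁ q ; (q-⇔ʳ q) → inj₂ q }) h₁ h₂

corollary3 : (φ : Formula) → QF φ → Sentence φ → (f : ℕ → ℕ) →
    ((𝓜 f ⊨ φ) ⇔
    (∃[ k ] ((g : ℕ → ℕ) → Extends g f k →
    (𝓜 g ⊨ φ) × (∀ i → i > k → ¬ Queries g φ i))))
corollary3 φ qf _ f with formulaModulus f (λ _ → 0) φ qf
... | k , h = mk⇔ settled-extensions (λ (_ , holds) → proj₁ (holds f (λ _ _ → refl)))
  where
    settled-extensions : 𝓜 f ⊨ φ → ∃[ k ] ((g : ℕ → ℕ) → Extends g f k →
      (𝓜 g ⊨ φ) × (∀ i → i > k → ¬ Queries g φ i))
    settled-extensions f⊨φ = k , λ g g≈f →
      Equivalence.from (agrees h g g≈f) f⊨φ ,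
      λ i i>k query → ≤⇒≯ (bounded h g g≈f i query) i>k
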